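{- Let $a,b\ge 2$ be integers and let $f_{(a,b,n)}$ and $t_{(a,b,n)}$ be as defined in the context. Then for every $n\ge 5$, $$f_{(a,b,n-1)}f_{(a,b,n-2)} = f_{(a,b,n-2)}t_{(a,b,n-1)} \qquad\text{and}\qquad f_{(a,b,n-1)}t_{(a,b,n-2)} = f_{(a,b,n-2)}f_{(a,b,n-1)}.$$
   Context: Words are over the alphabet $\{0,1\}$, with concatenation as the product; $w^k$ denotes the concatenation of $k$ copies of $w$ ($w^0$ is the empty word). For integers $a,b\ge 1$ the biperiodic Fibonacci words are defined by $f_{(a,b,0)}=0$, $f_{(a,b,1)}=0^{a-1}1$, and for $n\ge 2$: $f_{(a,b,n)} = f_{(a,b,n-1)}^{a}f_{(a,b,n-2)}$ if $n$ is even, and $f_{(a,b,n)} = f_{(a,b,n-1)}^{b}f_{(a,b,n-2)}$ if $n$ is odd. For a word $f_{(a,b,n)}$ with at least two letters, write $f_{(a,b,n)} = p\,xy$ with $x,y$ letters; then $t_{(a,b,n)} := p\,yx$ is $f_{(a,b,n)}$ with its last two letters interchanged. -}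

module Defs where

open import Data.Nat using (ℕ; zero; suc; _∸_)
open import Data.Bool using (Bool; true; false; if_then_else_)
open import Data.List using (List; []; _∷_; _++_; replicate)

data Bit : Set where
  b0 b1 : Bit

Word : Set
Word = List Bit

pow : Word → ℕ → Word
pow w zero    = []
pow w (suc k) = w ++ pow w k

isEven : ℕ → Bool
isEven zero          = true
isEven (suc zero)    = false
isEven (suc (suc n)) = isEven n

fib : ℕ → ℕ → ℕ → Word
fib a b zero          = b0 ∷ []
fib a b (suc zero)    = replicate (a ∸ 1) b0 ++ (b1 ∷ [])
fib a b (suc (suc n)) =
  pow (fib a b (suc n)) (if isEven n then a else b) ++ fib a b n

-- interchange the last two letters (p x y ↦ p y x); identity on words of
-- length < 2 (never used there in the theorem)
swapLast2 : Word → Word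
swapLast2 []               = []
swapLast2 (x ∷ [])         = x ∷ []
swapLast2 (x ∷ y ∷ [])     = y ∷ x ∷ []
swapLast2 (x ∷ y ∷ z ∷ w)  = x ∷ swapLast2 (y ∷ z ∷ w)

tw : ℕ → ℕ → ℕ → Word
tw a b n = swapLast2 (fib a b n)

-- Write A = f(k+1), B = f(k) and let t swap the last two letters. By induction on k,
--   A B = B t(A)   and   t(A B) = B A.
-- The step to (A^c B, A) only uses that t commutes with a prefix (t(u v) = u t(v) when
-- v has two letters) and that A^c commutes with A: e.g. A^c B A = A^c t(A B) = A t(A^c B).
-- The base case is a direct computation on f(1) = 0^(a-1) 1 and f(0) = 0; the theorem's
-- second identity is t(A B) = A t(B), again by commuting t with a prefix. The argument
-- only needs a ≥ 2 (so that every f(k+1) has two letters) and b ≥ 1.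
module Submission where

open import Defs
open import Data.Nat using (ℕ; _≤_; _∸_; zero; suc; s≤s)
open import Data.List using ([]; _∷_; _++_; replicate)
open import Data.List.Properties using (++-assoc)
open import Data.Bool using (true; false)
open import Data.Product using (_×_; _,_)
open import Relation.Binary.PropositionalEquality
open ≡-Reasoning

data Long : Word → Set where
  long : ∀ x y r → Long (x ∷ y ∷ r)

Long-++ˡ : ∀ u v → Long u → Long (u ++ v)
Long-++ˡ _ v (long x y r) = long x y (r ++ v)

Long-++ʳ : ∀ u v → Long v → Long (u ++ v)
Long-++ʳ []      v h = h
Long-++ʳ (x ∷ u) v h with u ++ v | Long-++ʳ u v h
... | _ | long y z r = long x y (z ∷ r)

Long-∷-++-∷ : ∀ x u y r → Long (x ∷ (u ++ y ∷ r))
Long-∷-++-∷ x []      y r = long x y r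
Long-∷-++-∷ x (z ∷ u) y r = long x z (u ++ y ∷ r)

Long-pow-++ : ∀ w c u → Long w → Long (pow w (suc c) ++ u)
Long-pow-++ w c u h = Long-++ˡ (w ++ pow w c) u (Long-++ˡ w (pow w c) h)

swapLast2-∷ : ∀ x w → Long w → swapLast2 (x ∷ w) ≡ x ∷ swapLast2 w
swapLast2-∷ x _ (long y z r) = refl

swapLast2-++ : ∀ u v → Long v → swapLast2 (u ++ v) ≡ u ++ swapLast2 v
swapLast2-++ []      v h = refl
swapLast2-++ (x ∷ u) v h = begin
  swapLast2 (x ∷ (u ++ v)) ≡⟨ swapLast2-∷ x (u ++ v) (Long-++ʳ u v h) ⟩
  x ∷ swapLast2 (u ++ v)   ≡⟨ cong (x ∷_) (swapLast2-++ u v h) ⟩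
  x ∷ (u ++ swapLast2 v)   ∎

pow-comm : ∀ w c u → pow w c ++ w ++ u ≡ w ++ pow w c ++ u
pow-comm w zero    u = refl
pow-comm w (suc c) u = begin
  (w ++ pow w c) ++ w ++ u ≡⟨ ++-assoc w (pow w c) (w ++ u) ⟩
  w ++ pow w c ++ w ++ u   ≡⟨ cong (w ++_) (pow-comm w c u) ⟩
  w ++ w ++ pow w c ++ u   ≡⟨ cong (w ++_) (sym (++-assoc w (pow w c) u)) ⟩
  w ++ (w ++ pow w c) ++ u ∎

replicate-++-∷ : ∀ n (x : Bit) r → replicate n x ++ x ∷ r ≡ x ∷ (replicate n x ++ r)
replicate-++-∷ zero    x r = refl
replicate-++-∷ (suc n) x r = cong (x ∷_) (replicate-++-∷ n x r)

FibPair : Word → Word → Set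
FibPair A B = (A ++ B ≡ B ++ swapLast2 A) × (swapLast2 (A ++ B) ≡ B ++ A)

FibPair-step : ∀ A B c → Long A → FibPair A B → FibPair (pow A (suc c) ++ B) A
FibPair-step A B c lA (AB≡Bt , tAB≡BA) = prepend , swapped
  where
  prepend : (pow A (suc c) ++ B) ++ A ≡ A ++ swapLast2 (pow A (suc c) ++ B)
  prepend = begin
    (pow A (suc c) ++ B) ++ A
      ≡⟨ ++-assoc (pow A (suc c)) B A ⟩
    pow A (suc c) ++ B ++ A
      ≡⟨ cong (pow A (suc c) ++_) (sym tAB≡BA) ⟩
    (A ++ pow A c) ++ swapLast2 (A ++ B)
      ≡⟨ ++-assoc A (pow A c) _ ⟩
    A ++ pow A c ++ swapLast2 (A ++ B)
      ≡⟨ cong (A ++_) (sym (swapLast2-++ (pow A c) (A ++ B) (Long-++ˡ A B lA))) ⟩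
    A ++ swapLast2 (pow A c ++ A ++ B)
      ≡⟨ cong (λ w → A ++ swapLast2 w) (pow-comm A c B) ⟩
    A ++ swapLast2 (A ++ pow A c ++ B)
      ≡⟨ cong (λ w → A ++ swapLast2 w) (sym (++-assoc A (pow A c) B)) ⟩
    A ++ swapLast2 (pow A (suc c) ++ B) ∎

  swapped : swapLast2 ((pow A (suc c) ++ B) ++ A) ≡ A ++ (pow A (suc c) ++ B)
  swapped = begin
    swapLast2 ((pow A (suc c) ++ B) ++ A) ≡⟨ cong swapLast2 (++-assoc (pow A (suc c)) B A) ⟩
    swapLast2 (pow A (suc c) ++ B ++ A)   ≡⟨ swapLast2-++ (pow A (suc c)) (B ++ A) (Long-++ʳ B A lA) ⟩
    pow A (suc c) ++ swapLast2 (B ++ A)   ≡⟨ cong (pow A (suc c) ++_) (swapLast2-++ B A lA) ⟩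
    pow A (suc c) ++ B ++ swapLast2 A     ≡⟨ cong (pow A (suc c) ++_) (sym AB≡Bt) ⟩
    pow A (suc c) ++ A ++ B               ≡⟨ pow-comm A (suc c) B ⟩
    A ++ pow A (suc c) ++ B               ∎

FibPair-base : ∀ m → FibPair (replicate (suc m) b0 ++ b1 ∷ []) (b0 ∷ [])
FibPair-base m = prepend , swapped
  where
  prepend : (b0 ∷ (replicate m b0 ++ b1 ∷ [])) ++ b0 ∷ []
          ≡ b0 ∷ swapLast2 (b0 ∷ (replicate m b0 ++ b1 ∷ []))
  prepend = cong (b0 ∷_) (begin
    (replicate m b0 ++ b1 ∷ []) ++ b0 ∷ []
      ≡⟨ ++-assoc (replicate m b0) (b1 ∷ []) (b0 ∷ []) ⟩
    replicate m b0 ++ b1 ∷ b0 ∷ []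
      ≡⟨ sym (swapLast2-++ (replicate m b0) (b0 ∷ b1 ∷ []) (long b0 b1 [])) ⟩
    swapLast2 (replicate m b0 ++ b0 ∷ b1 ∷ [])
      ≡⟨ cong swapLast2 (replicate-++-∷ m b0 (b1 ∷ [])) ⟩
    swapLast2 (b0 ∷ (replicate m b0 ++ b1 ∷ [])) ∎)

  swapped : swapLast2 ((replicate (suc m) b0 ++ b1 ∷ []) ++ b0 ∷ [])
          ≡ b0 ∷ (replicate (suc m) b0 ++ b1 ∷ [])
  swapped = begin
    swapLast2 ((replicate (suc m) b0 ++ b1 ∷ []) ++ b0 ∷ [])
      ≡⟨ cong swapLast2 (++-assoc (replicate (suc m) b0) (b1 ∷ []) (b0 ∷ [])) ⟩
    swapLast2 (replicate (suc m) b0 ++ b1 ∷ b0 ∷ [])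
      ≡⟨ swapLast2-++ (replicate (suc m) b0) (b1 ∷ b0 ∷ []) (long b1 b0 []) ⟩
    replicate (suc m) b0 ++ b0 ∷ b1 ∷ []
      ≡⟨ replicate-++-∷ (suc m) b0 (b1 ∷ []) ⟩
    b0 ∷ (replicate (suc m) b0 ++ b1 ∷ []) ∎

module _ (a' b' : ℕ) where
  private
    F : ℕ → Word
    F = fib (suc (suc a')) (suc b')

  fib-Long : ∀ k → Long (F (suc k))
  fib-Long zero = Long-∷-++-∷ b0 (replicate a' b0) b1 []
  fib-Long (suc k) with isEven k
  ... | true  = Long-pow-++ (F (suc k)) (suc a') (F k) (fib-Long k)
  ... | false = Long-pow-++ (F (suc k)) b' (F k) (fib-Long k)

  fib-FibPair : ∀ k → FibPair (F (suc k)) (F k)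
  fib-FibPair zero = FibPair-base a'
  fib-FibPair (suc k) with isEven k
  ... | true  = FibPair-step (F (suc k)) (F k) (suc a') (fib-Long k) (fib-FibPair k)
  ... | false = FibPair-step (F (suc k)) (F k) b' (fib-Long k) (fib-FibPair k)

mainTheorem1 : (a b n : ℕ) → 2 ≤ a → 2 ≤ b → 5 ≤ n →
    (fib a b (n ∸ 1) ++ fib a b (n ∸ 2) ≡ fib a b (n ∸ 2) ++ tw a b (n ∸ 1))
    × (fib a b (n ∸ 1) ++ tw a b (n ∸ 2) ≡ fib a b (n ∸ 2) ++ fib a b (n ∸ 1))
mainTheorem1 (suc (suc a')) (suc b') (suc (suc (suc (suc (suc k)))))
             (s≤s (s≤s _)) (s≤s _) (s≤s (s≤s (s≤s (s≤s (s≤s _)))))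
  with fib-FibPair a' b' (suc (suc (suc k)))
... | AB≡Bt , tAB≡BA =
  AB≡Bt , trans (sym (swapLast2-++ _ _ (fib-Long a' b' (suc (suc k))))) tAB≡BA
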